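{- Fix $T$ with $1<T<\tfrac43$ and $n\ge 3$. For every initial configuration $C_0$ on the $n$-vertex cycle, the PD process started from $C_0$ reaches some $i\ge 0$ with $W_i=\emptyset$, i.e. it terminates in a stable configuration.
   Context: A configuration on a graph $G=(V,E)$ is a map $C:V\to\{0,1\}$; $1$ means cooperator, $0$ means defector. The pay-off $f(a,b)$ to a player with strategy $a$ against strategy $b$ is $f(0,0)=0$, $f(0,1)=T$, $f(1,0)=0$, $f(1,1)=1$. The score of $v$ is $s(v)=\sum_{x\in N(v)} f(C(v),C(x))$. The most successful neighbours of $v$ are the vertices of $N[v]$ of maximum score (defectors taken as most successful in case of a tie between a cooperator and a defector). A vertex is weak if its strategy differs from that of its most successful neighbours; updating a vertex changes its strategy if it is currently weak and does nothing otherwise. PD process: given $C_t$, let $W_t$ be the set of weak vertices; if $W_t=\emptyset$ the process stops and $C_t$ is stable. Otherwise a uniformly random ordering of $W_t$ is chosen and the vertices are updated one at a time in that order, each with respect to the current configuration, producing $C_{t+1}$.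
   Formalization: The parameter T, with $1<T<\tfrac43$, ranges over the rationals. -}

module Defs where

open import Data.Bool using (Bool; true; false; not; _∧_; if_then_else_)
open import Data.Nat using (ℕ; zero; suc; _+_)
open import Data.Nat.DivMod using (_%_; m%n<n)
open import Data.Fin using (Fin; toℕ; fromℕ<; _≟_)
open import Data.List using (List; []; _∷_)
open import Data.Bool.ListAction using (any)
open import Data.List.Relation.Binary.Permutation.Propositional using (_↭_)
open import Data.Product using (Σ; _×_; ∃)
open import Data.Rational using (ℚ; 0ℚ; 1ℚ; _⊔_)
import Data.Rational.Properties as ℚP
open import Relation.Nullary using (does; ¬_)
open import Relation.Binary.PropositionalEquality using (_≡_)
import Data.List as L

-- Strategies: true = cooperator (1), false = defector (0).
Config : ℕ → Set
Config n = Fin n → Bool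

next : ∀ {n} → Fin n → Fin n
next {suc m} i = fromℕ< (m%n<n (suc (toℕ i)) (suc m))

prev : ∀ {n} → Fin n → Fin n
prev {suc m} i = fromℕ< (m%n<n (toℕ i + m) (suc m))

payoff : ℚ → Bool → Bool → ℚ
payoff T false false = 0ℚ
payoff T false true  = T
payoff T true  false = 0ℚ
payoff T true  true  = 1ℚ

-- Score on the cycle: N(v) = {prev v, next v} (two distinct vertices for n ≥ 3).
score : ℚ → ∀ {n} → Config n → Fin n → ℚ
score T C v = payoff T (C v) (C (prev v)) Data.Rational.+ payoff T (C v) (C (next v))

closedNbhd : ∀ {n} → Fin n → List (Fin n)
closedNbhd v = v ∷ prev v ∷ next v ∷ []

maxScore : ℚ → ∀ {n} → Config n → Fin n → ℚ
maxScore T C v = score T C v ⊔ (score T C (prev v) ⊔ score T C (next v))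

-- Strategy of the most successful neighbours of v: defector if some defector
-- of N[v] has the maximum score (defectors win ties), otherwise cooperator.
bestStrategy : ℚ → ∀ {n} → Config n → Fin n → Bool
bestStrategy T C v =
  not (any (λ u → not (C u) ∧ does (score T C u ℚP.≟ maxScore T C v)) (closedNbhd v))

_==ᵇ_ : Bool → Bool → Bool
true  ==ᵇ b = b
false ==ᵇ b = not b

isWeak : ℚ → ∀ {n} → Config n → Fin n → Bool
isWeak T C v = not (C v ==ᵇ bestStrategy T C v)

-- The set W of weak vertices, as a duplicate-free list.
weakList : ℚ → ∀ {n} → Config n → List (Fin n)
weakList T {n} C = L.filter (λ v → isWeak T C v Data.Bool.≟ true) (L.allFin n)

Stable : ℚ → ∀ {n} → Config n → Set
Stable T C = weakList T C ≡ []

updateVertex : ℚ → ∀ {n} → Config n → Fin n → Config n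
updateVertex T C v u with does (u ≟ v)
... | true  = if isWeak T C v then not (C u) else C u
... | false = C u

updateSeq : ℚ → ∀ {n} → Config n → List (Fin n) → Config n
updateSeq T C []       = C
updateSeq T C (v ∷ vs) = updateSeq T (updateVertex T C v) vs

-- A run of the PD process: at every time t, C_{t+1} is obtained from C_t by
-- updating the weak vertices W_t in some ordering σ_t of W_t.
-- (When W_t = ∅ the only ordering is [] and C_{t+1} = C_t.)
IsRun : ℚ → ∀ {n} → (ℕ → Config n) → Set
IsRun T {n} C = ∀ t → Σ (List (Fin n)) λ σ →
  (σ ↭ weakList T (C t)) × (∀ u → C (suc t) u ≡ updateSeq T (C t) σ u)

-- For T > 1 a defector is never weak: if it has a cooperating neighbour it
-- scores at least T, while each of its neighbours, having it as a defecting
-- neighbour, scores at most T, and defectors win ties; if it has none, all of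
-- N[v] defect.  Hence only cooperators change strategy, so the number of
-- cooperators strictly decreases in every round with W_t ≠ ∅, and the process
-- stops within |C_0⁻¹(1)| rounds.
module Submission where

open import Defs
open import Data.Nat using (ℕ; _≤_)
open import Data.Integer using (+_)
open import Data.Rational using (ℚ; 1ℚ; _<_; _/_)
open import Data.Product using (Σ; _×_)
open import Data.Fin using (Fin)
open import Relation.Binary.PropositionalEquality using (_≡_)

open import Data.Bool.Base as B using (Bool; true; false; not; f≤t; b≤b; f<t)
  renaming (T to IsTrue)
import Data.Bool.Properties as BP
open import Data.Empty using (⊥-elim)
open import Data.Fin as F using (zero; suc; toℕ)
import Data.Fin.Properties as FP
open import Data.List using ([]; _∷_; allFin)
open import Data.List.Membership.Propositional using (_∈_)
open import Data.List.Membership.Propositional.Properties using (∈-filter⁻)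
open import Data.List.Relation.Binary.Permutation.Propositional using (↭-sym)
open import Data.List.Relation.Binary.Permutation.Propositional.Properties using (∈-resp-↭)
import Data.List.Relation.Unary.Any as Any
open import Data.List.Relation.Unary.Any using (here; there)
open import Data.List.Relation.Unary.Any.Properties using (any⁺)
import Data.Nat as ℕ
open import Data.Nat.DivMod
  using (_%_; m%n<n; %-distribˡ-+; m%n%n≡m%n; [m+n]%n≡m%n; m<n⇒m%n≡m)
import Data.Nat.Properties as ℕP
open import Data.Product using (_,_; proj₂; ∃-syntax)
open import Data.Rational as ℚ using (0ℚ; _⊔_)
import Data.Rational.Properties as ℚP
open import Data.Sum using (_⊎_; inj₁; inj₂)
open import Function using (_∘_; Equivalence)
open import Relation.Nullary.Decidable using (does; yes; no; dec-true)
open import Relation.Binary.PropositionalEquality using (refl; sym; trans; cong; cong₂; subst; module ≡-Reasoning)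

[m%d+n]%d≡[m+n]%d : ∀ m n d .{{_ : ℕ.NonZero d}} → (m % d ℕ.+ n) % d ≡ (m ℕ.+ n) % d
[m%d+n]%d≡[m+n]%d m n d = begin
  (m % d ℕ.+ n) % d          ≡⟨ %-distribˡ-+ (m % d) n d ⟩
  (m % d % d ℕ.+ n % d) % d  ≡⟨ cong (λ k → (k ℕ.+ n % d) % d) (m%n%n≡m%n m d) ⟩
  (m % d ℕ.+ n % d) % d      ≡⟨ %-distribˡ-+ m n d ⟨
  (m ℕ.+ n) % d              ∎
  where open ≡-Reasoning

[m+n%d]%d≡[m+n]%d : ∀ m n d .{{_ : ℕ.NonZero d}} → (m ℕ.+ n % d) % d ≡ (m ℕ.+ n) % d
[m+n%d]%d≡[m+n]%d m n d = begin
  (m ℕ.+ n % d) % d  ≡⟨ cong (_% d) (ℕP.+-comm m (n % d)) ⟩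
  (n % d ℕ.+ m) % d  ≡⟨ [m%d+n]%d≡[m+n]%d n m d ⟩
  (n ℕ.+ m) % d      ≡⟨ cong (_% d) (ℕP.+-comm n m) ⟩
  (m ℕ.+ n) % d      ∎
  where open ≡-Reasoning

[i+1+m]%[1+m]≡i : ∀ {m} (i : Fin (ℕ.suc m)) → (toℕ i ℕ.+ ℕ.suc m) % ℕ.suc m ≡ toℕ i
[i+1+m]%[1+m]≡i {m} i = trans ([m+n]%n≡m%n (toℕ i) (ℕ.suc m)) (m<n⇒m%n≡m (FP.toℕ<n i))

next-prev : ∀ {n} (v : Fin n) → next (prev v) ≡ v
next-prev {ℕ.suc m} v = FP.toℕ-injective (begin
  toℕ (next (prev v))                     ≡⟨ FP.toℕ-fromℕ< _ ⟩
  (1 ℕ.+ toℕ (prev v)) % ℕ.suc m          ≡⟨ cong (λ k → (1 ℕ.+ k) % ℕ.suc m) (FP.toℕ-fromℕ< (m%n<n (toℕ v ℕ.+ m) (ℕ.suc m))) ⟩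
  (1 ℕ.+ (toℕ v ℕ.+ m) % ℕ.suc m) % ℕ.suc m  ≡⟨ [m+n%d]%d≡[m+n]%d 1 (toℕ v ℕ.+ m) (ℕ.suc m) ⟩
  (1 ℕ.+ (toℕ v ℕ.+ m)) % ℕ.suc m         ≡⟨ cong (_% ℕ.suc m) (ℕP.+-suc (toℕ v) m) ⟨
  (toℕ v ℕ.+ ℕ.suc m) % ℕ.suc m           ≡⟨ [i+1+m]%[1+m]≡i v ⟩
  toℕ v                                   ∎)
  where open ≡-Reasoning

prev-next : ∀ {n} (v : Fin n) → prev (next v) ≡ v
prev-next {ℕ.suc m} v = FP.toℕ-injective (begin
  toℕ (prev (next v))                     ≡⟨ FP.toℕ-fromℕ< _ ⟩
  (toℕ (next v) ℕ.+ m) % ℕ.suc m          ≡⟨ cong (λ k → (k ℕ.+ m) % ℕ.suc m) (FP.toℕ-fromℕ< (m%n<n (1 ℕ.+ toℕ v) (ℕ.suc m))) ⟩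
  ((1 ℕ.+ toℕ v) % ℕ.suc m ℕ.+ m) % ℕ.suc m  ≡⟨ [m%d+n]%d≡[m+n]%d (1 ℕ.+ toℕ v) m (ℕ.suc m) ⟩
  (1 ℕ.+ toℕ v ℕ.+ m) % ℕ.suc m           ≡⟨ cong (_% ℕ.suc m) (ℕP.+-suc (toℕ v) m) ⟨
  (toℕ v ℕ.+ ℕ.suc m) % ℕ.suc m           ≡⟨ [i+1+m]%[1+m]≡i v ⟩
  toℕ v                                   ∎)
  where open ≡-Reasoning

maxScore-attained : ∀ T {n} (C : Config n) v →
  ∃[ u ] u ∈ closedNbhd v × score T C u ≡ maxScore T C v
maxScore-attained T C v
  with ℚP.⊔-sel (score T C v) (score T C (prev v) ⊔ score T C (next v))
... | inj₁ eq = v , here refl , sym eq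
... | inj₂ eq with ℚP.⊔-sel (score T C (prev v)) (score T C (next v))
...   | inj₁ eq′ = prev v , there (here refl) , sym (trans eq eq′)
...   | inj₂ eq′ = next v , there (there (here refl)) , sym (trans eq eq′)

bestStrategy-defector : ∀ T {n} (C : Config n) {v u} → u ∈ closedNbhd v →
  C u ≡ false → score T C u ≡ maxScore T C v → bestStrategy T C v ≡ false
bestStrategy-defector T C {v} u∈N[v] Cu≡false best =
  cong not (Equivalence.to BP.T-≡ (any⁺ isBestDefector (Any.map witness u∈N[v])))
  where
  isBestDefector : Fin _ → Bool
  isBestDefector w = not (C w) B.∧ does (score T C w ℚP.≟ maxScore T C v)
  witness : ∀ {w} → _ ≡ w → IsTrue (isBestDefector w)
  witness refl rewrite Cu≡false | dec-true (_ ℚP.≟ maxScore T C v) best = _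

≡true⊎≡false : ∀ b → b ≡ true ⊎ b ≡ false
≡true⊎≡false true  = inj₁ refl
≡true⊎≡false false = inj₂ refl

p≤p+q : ∀ {p q} → 0ℚ ℚ.≤ q → p ℚ.≤ p ℚ.+ q
p≤p+q {p} {q} 0≤q = begin
  p          ≡⟨ ℚP.+-identityʳ p ⟨
  p ℚ.+ 0ℚ   ≤⟨ ℚP.+-monoʳ-≤ p 0≤q ⟩
  p ℚ.+ q    ∎
  where open ℚP.≤-Reasoning

p≤q+p : ∀ {p q} → 0ℚ ℚ.≤ q → p ℚ.≤ q ℚ.+ p
p≤q+p {p} {q} 0≤q = ℚP.≤-trans (p≤p+q 0≤q) (ℚP.≤-reflexive (ℚP.+-comm p q))

module _ (T : ℚ) (1<T : 1ℚ < T) where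

  0≤T : 0ℚ ℚ.≤ T
  0≤T = ℚP.≤-trans (ℚP.nonNegative⁻¹ 1ℚ) (ℚP.<⇒≤ 1<T)

  payoff-≤-T : ∀ a b → payoff T a b ℚ.≤ T
  payoff-≤-T false false = 0≤T
  payoff-≤-T false true  = ℚP.≤-refl
  payoff-≤-T true  false = 0≤T
  payoff-≤-T true  true  = ℚP.<⇒≤ 1<T

  payoff-nonNeg : ∀ a b → 0ℚ ℚ.≤ payoff T a b
  payoff-nonNeg false false = ℚP.≤-refl
  payoff-nonNeg false true  = 0≤T
  payoff-nonNeg true  false = ℚP.≤-refl
  payoff-nonNeg true  true  = ℚP.nonNegative⁻¹ 1ℚ

  payoff-vs-defector : ∀ a → payoff T a false ≡ 0ℚ
  payoff-vs-defector false = refl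
  payoff-vs-defector true  = refl

  score-≤-T : ∀ {n} (C : Config n) u → C (prev u) ≡ false ⊎ C (next u) ≡ false →
    score T C u ℚ.≤ T
  score-≤-T C u (inj₁ Cp≡false)
    rewrite Cp≡false | payoff-vs-defector (C u) | ℚP.+-identityˡ (payoff T (C u) (C (next u)))
    = payoff-≤-T (C u) (C (next u))
  score-≤-T C u (inj₂ Cn≡false)
    rewrite Cn≡false | payoff-vs-defector (C u) | ℚP.+-identityʳ (payoff T (C u) (C (prev u)))
    = payoff-≤-T (C u) (C (prev u))

  T-≤-score : ∀ {n} (C : Config n) v → C v ≡ false → C (prev v) ≡ true ⊎ C (next v) ≡ true →
    T ℚ.≤ score T C v
  T-≤-score C v Cv≡false (inj₁ Cp≡true) rewrite Cv≡false | Cp≡true = p≤p+q (payoff-nonNeg false (C (next v)))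
  T-≤-score C v Cv≡false (inj₂ Cn≡true) rewrite Cv≡false | Cn≡true = p≤q+p (payoff-nonNeg false (C (prev v)))

  defector-score≡maxScore : ∀ {n} (C : Config n) v → C v ≡ false →
    C (prev v) ≡ true ⊎ C (next v) ≡ true → score T C v ≡ maxScore T C v
  defector-score≡maxScore C v Cv≡false coop =
    sym (ℚP.p≥q⇒p⊔q≡p (ℚP.⊔-lub (bounded (prev v) (inj₂ (trans (cong C (next-prev v)) Cv≡false)))
                                 (bounded (next v) (inj₁ (trans (cong C (prev-next v)) Cv≡false)))))
    where
    bounded : ∀ u → C (prev u) ≡ false ⊎ C (next u) ≡ false → score T C u ℚ.≤ score T C v
    bounded u defectingNeighbour = ℚP.≤-trans (score-≤-T C u defectingNeighbour) (T-≤-score C v Cv≡false coop)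

  defector-bestStrategy : ∀ {n} (C : Config n) v → C v ≡ false → bestStrategy T C v ≡ false
  defector-bestStrategy C v Cv≡false with ≡true⊎≡false (C (prev v)) | ≡true⊎≡false (C (next v))
  ... | inj₁ Cp | _ =
    bestStrategy-defector T C (here refl) Cv≡false (defector-score≡maxScore C v Cv≡false (inj₁ Cp))
  ... | inj₂ _ | inj₁ Cn =
    bestStrategy-defector T C (here refl) Cv≡false (defector-score≡maxScore C v Cv≡false (inj₂ Cn))
  ... | inj₂ Cp | inj₂ Cn with maxScore-attained T C v
  ...   | u , u∈N[v] , best = bestStrategy-defector T C u∈N[v] (defects u∈N[v]) best
    where
    defects : ∀ {u} → u ∈ closedNbhd v → C u ≡ false
    defects (here refl)                 = Cv≡false
    defects (there (here refl))         = Cp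
    defects (there (there (here refl))) = Cn

  defector-not-weak : ∀ {n} (C : Config n) v → C v ≡ false → isWeak T C v ≡ false
  defector-not-weak C v Cv≡false =
    cong₂ (λ a b → not (a ==ᵇ b)) Cv≡false (defector-bestStrategy C v Cv≡false)

  weak⇒cooperator : ∀ {n} (C : Config n) v → isWeak T C v ≡ true → C v ≡ true
  weak⇒cooperator C v weak with ≡true⊎≡false (C v)
  ... | inj₁ Cv = Cv
  ... | inj₂ Cv with () ← trans (sym weak) (defector-not-weak C v Cv)

  updateVertex-≤ : ∀ {n} (C : Config n) v u → updateVertex T C v u B.≤ C u
  updateVertex-≤ C v u with u F.≟ v
  ... | no _ = b≤b
  ... | yes refl with ≡true⊎≡false (isWeak T C u)
  ...   | inj₂ notWeak rewrite notWeak = b≤b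
  ...   | inj₁ weak rewrite weak | weak⇒cooperator C u weak = f≤t

  updateVertex-< : ∀ {n} (C : Config n) v → isWeak T C v ≡ true → updateVertex T C v v B.< C v
  updateVertex-< C v weak with v F.≟ v
  ... | no v≢v = ⊥-elim (v≢v refl)
  ... | yes refl rewrite weak | weak⇒cooperator C v weak = f<t

  updateSeq-≤ : ∀ {n} (C : Config n) σ u → updateSeq T C σ u B.≤ C u
  updateSeq-≤ C []       u = b≤b
  updateSeq-≤ C (v ∷ σ) u = BP.≤-trans (updateSeq-≤ (updateVertex T C v) σ u) (updateVertex-≤ C v u)

  updateSeq-<-head : ∀ {n} (C : Config n) v σ → isWeak T C v ≡ true → updateSeq T C (v ∷ σ) v B.< C v
  updateSeq-<-head C v σ weak = BP.<-transʳ (updateSeq-≤ (updateVertex T C v) σ v) (updateVertex-< C v weak)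

indicator : Bool → ℕ
indicator false = 0
indicator true  = 1

cooperators : ∀ {n} → Config n → ℕ
cooperators {ℕ.zero}  C = 0
cooperators {ℕ.suc n} C = indicator (C zero) ℕ.+ cooperators (C ∘ suc)

indicator-mono-≤ : ∀ {a b} → a B.≤ b → indicator a ≤ indicator b
indicator-mono-≤ f≤t = ℕ.z≤n
indicator-mono-≤ b≤b = ℕP.≤-refl

indicator-mono-< : ∀ {a b} → a B.< b → indicator a ℕ.< indicator b
indicator-mono-< f<t = ℕP.≤-refl

cooperators-mono-≤ : ∀ {n} {C D : Config n} → (∀ u → D u B.≤ C u) → cooperators D ≤ cooperators C
cooperators-mono-≤ {ℕ.zero}  D≤C = ℕ.z≤n
cooperators-mono-≤ {ℕ.suc n} D≤C = ℕP.+-mono-≤ (indicator-mono-≤ (D≤C zero)) (cooperators-mono-≤ (D≤C ∘ suc))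

cooperators-mono-< : ∀ {n} {C D : Config n} → (∀ u → D u B.≤ C u) → ∀ u → D u B.< C u →
  cooperators D ℕ.< cooperators C
cooperators-mono-< D≤C zero    D<C =
  ℕP.+-mono-<-≤ (indicator-mono-< D<C) (cooperators-mono-≤ (D≤C ∘ suc))
cooperators-mono-< D≤C (suc u) D<C =
  ℕP.+-mono-≤-< (indicator-mono-≤ (D≤C zero)) (cooperators-mono-< (D≤C ∘ suc) u D<C)

module _ (T : ℚ) (1<T : 1ℚ < T) {n} {C : ℕ → Config n} (run : IsRun T C) where

  cooperators-decrease : ∀ {t w ws} → weakList T (C t) ≡ w ∷ ws →
    cooperators (C (ℕ.suc t)) ℕ.< cooperators (C t)
  cooperators-decrease {t} {w} W≡w∷ws with run t
  ... | [] , σ↭W , _ with () ← ∈-resp-↭ (↭-sym σ↭W) (subst (w ∈_) (sym W≡w∷ws) (here refl))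
  ... | v ∷ σ , σ↭W , C[t+1]≡ = cooperators-mono-< lowered v flipped
    where
    weak : isWeak T (C t) v ≡ true
    weak = proj₂ (∈-filter⁻ (λ u → isWeak T (C t) u BP.≟ true) {xs = allFin _} (∈-resp-↭ σ↭W (here refl)))
    lowered : ∀ u → C (ℕ.suc t) u B.≤ C t u
    lowered u = subst (B._≤ C t u) (sym (C[t+1]≡ u)) (updateSeq-≤ T 1<T (C t) (v ∷ σ) u)
    flipped : C (ℕ.suc t) v B.< C t v
    flipped = subst (B._< C t v) (sym (C[t+1]≡ v)) (updateSeq-<-head T 1<T (C t) v σ weak)

  stable-within : ∀ k t → cooperators (C t) ≤ k → Σ ℕ λ i → Stable T (C i)
  stable-within k t bound with weakList T (C t) in W
  ... | [] = t , W
  ... | w ∷ ws with k | ℕP.<-≤-trans (cooperators-decrease W) bound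
  ...   | ℕ.suc k | lt = stable-within k (ℕ.suc t) (ℕP.≤-pred lt)

theorem4p3 : (T : ℚ) → 1ℚ < T → T < (+ 4) / 3 →
    (n : ℕ) → 3 ≤ n → (C : ℕ → Config n) → IsRun T C →
    Σ ℕ λ i → Stable T (C i)
theorem4p3 T 1<T _ n _ C run = stable-within T 1<T run (cooperators (C 0)) 0 ℕP.≤-refl
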